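{- Let $n\ge2$, $1\le k\le n$ and $\lambda\vdash n$. For a standard Young tableau $S$ of shape $\lambda$ let $$\mathrm{eig}(S)=\frac1n+\frac{2(n-1)}{nk(2n-(k+1))}D^k_S,\qquad D^k_S=\sum_{(i,j):\,n-k<S(i,j)\le n}(j-i),$$ where $S(i,j)$ is the entry in row $i$, column $j$. Then for every standard Young tableau $S$ of shape $\lambda$, $$\mathrm{eig}(T_{\lambda^{\to}})\le\mathrm{eig}(S)\le\mathrm{eig}(T_{\lambda^{\downarrow}}),$$ i.e. the column-insertion tableau maximizes $D^k_S$ and the row-insertion tableau minimizes it among tableaux of shape $\lambda$.
   Context: Rows are indexed top to bottom from 1 and columns left to right from 1. A standard Young tableau of shape $\lambda$ fills the diagram with $1,\dots,n$ increasing along rows and down columns. The row-insertion tableau $T_{\lambda^{\to}}$ is obtained by writing $1,2,\dots,n$ row by row, left to right, starting from the top row; the column-insertion tableau $T_{\lambda^{\downarrow}}$ by writing $1,2,\dots,n$ column by column, top to bottom, starting from the leftmost column. -}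

module Defs where

open import Data.Nat as ℕ using (ℕ; zero; suc; _+_; _*_; _∸_; _≤_; _<_; _≥_; _≤?_; _<?_)
open import Data.Integer as ℤ using (ℤ; +_)
open import Data.Rational as ℚ using (ℚ; 0ℚ; _/_)
open import Data.List using (List; []; _∷_; map; _++_; upTo; filter; length; take; foldr)
open import Data.Nat.ListAction using (sum)
open import Data.List.Relation.Unary.All using (All)
open import Data.List.Relation.Unary.Linked using (Linked)
open import Data.Product using (_×_; _,_; proj₁; proj₂)
open import Relation.Nullary.Decidable using (_×-dec_)
open import Relation.Binary.PropositionalEquality using (_≡_)

Partition : ℕ → List ℕ → Set
Partition n λs = (sum λs ≡ n) × All (λ x → 0 < x) λs × Linked _≥_ λs

-- Length of row i (rows indexed from 1); 0 outside the diagram.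
rowLen : List ℕ → ℕ → ℕ
rowLen [] _ = 0
rowLen (x ∷ xs) zero = 0
rowLen (x ∷ xs) (suc zero) = x
rowLen (x ∷ xs) (suc (suc i)) = rowLen xs (suc i)

colLen : List ℕ → ℕ → ℕ
colLen λs c = length (filter (c ≤?_) λs)

InShape : List ℕ → ℕ → ℕ → Set
InShape λs i j = 1 ≤ i × 1 ≤ j × j ≤ rowLen λs i

-- A filling assigns a natural number to each (row, column) position
-- (values outside the diagram are irrelevant).
Filling : Set
Filling = ℕ → ℕ → ℕ

-- Standard Young tableau of shape λ ⊢ n: entries in {1,…,n}, each
-- used at most once (hence exactly once, as the diagram has n cells),
-- strictly increasing along rows and down columns.
record SYT (n : ℕ) (λs : List ℕ) (S : Filling) : Set where
  field
    range   : ∀ i j → InShape λs i j → 1 ≤ S i j × S i j ≤ n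
    inj     : ∀ i j i' j' → InShape λs i j → InShape λs i' j' →
              S i j ≡ S i' j' → (i ≡ i') × (j ≡ j')
    rowIncr : ∀ i j → InShape λs i (suc j) → S i j < S i (suc j)
    colIncr : ∀ i j → InShape λs (suc i) j → S i j < S (suc i) j

cellsFrom : ℕ → List ℕ → List (ℕ × ℕ)
cellsFrom r [] = []
cellsFrom r (x ∷ xs) = map (λ j → (r , suc j)) (upTo x) ++ cellsFrom (suc r) xs

cells : List ℕ → List (ℕ × ℕ)
cells = cellsFrom 1

sumℤ : List ℤ → ℤ
sumℤ = foldr ℤ._+_ (+ 0)

D : ℕ → ℕ → List ℕ → Filling → ℤ
D n k λs S =
  sumℤ (map (λ c → (+ proj₂ c) ℤ.- (+ proj₁ c))
            (filter (λ c → ((n ∸ k) <? S (proj₁ c) (proj₂ c)) ×-dec (S (proj₁ c) (proj₂ c) ≤? n))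
                    (cells λs)))

-- Division by a natural number; junk value 0 when dividing by 0
-- (never happens under the hypotheses n ≥ 2, 1 ≤ k ≤ n).
_/'_ : ℤ → ℕ → ℚ
z /' zero = 0ℚ
z /' suc m = z / suc m

eig : ℕ → ℕ → List ℕ → Filling → ℚ
eig n k λs S =
  ((+ 1) /' n) ℚ.+ (((+ (2 * (n ∸ 1))) /' (n * k * (2 * n ∸ (k + 1)))) ℚ.* (D n k λs S /' 1))

-- Row-insertion tableau T_{λ→}: 1..n written row by row.
rowTableau : List ℕ → Filling
rowTableau λs i j = sum (take (i ∸ 1) λs) + j

-- Column-insertion tableau T_{λ↓}: 1..n written column by column.
colTableau : List ℕ → Filling
colTableau λs i j = sum (map (colLen λs) (map suc (upTo (j ∸ 1)))) + i

{-# OPTIONS --safe #-}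
-- Put m = n − k, so that D^k_T is the total content j − i of the cells whose entry lies in
-- (m, n].  A filling using each of 1, …, n once has exactly k such cells, so for two such
-- fillings S and T the cells counted only for S and those counted only for T are equally
-- many, and D_T ≤ D_S as soon as every cell of the second kind has content at most that of
-- every cell of the first kind.  Take T the row reading tableau, x counted only for S and y
-- only for T: then y is read after x although S y < S x.  Being read later, y lies weakly
-- below x; since S increases along rows and columns, y is not weakly right of x either, so
-- content y ≤ content x.  The column reading tableau is the row reading tableau of the
-- conjugate shape, transposed, and the same argument with rows and columns exchanged shows
-- D_S ≤ D_col.  Finally eig is an increasing affine function of D.
module Submission where

open import Defs
open import Data.Empty using (⊥)
open import Data.Integer as ℤ using (ℤ)
import Data.Integer.Properties as ℤP
open import Algebra.Properties.CommutativeSemigroup ℤP.+-commutativeSemigroup using (x∙yz≈y∙xz)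
open import Data.List using (List; []; _∷_; map; _++_; filter; length; applyUpTo; upTo; take)
open import Data.List.Properties
  using ( applyUpTo-∷ʳ; filter-accept; filter-reject; filter-≐; length-++; length-applyUpTo
        ; length-map; length-upTo; map-++; map-∘; map-applyUpTo; map-upTo)
open import Data.List.Membership.Propositional using (_∈_)
open import Data.List.Membership.Propositional.Properties
  using (∈-applyUpTo⁺; ∈-filter⁻; ∈-++⁻; ∈-map⁻; ∈-upTo⁻)
open import Data.List.Relation.Binary.Subset.Propositional using (_⊆_)
open import Data.List.Relation.Unary.All as All using (All; _∷_)
open import Data.List.Relation.Unary.All.Properties using (all-filter) renaming (map⁺ to All-map⁺)
open import Data.List.Relation.Unary.AllPairs using ([]; _∷_)
open import Data.List.Relation.Unary.Any using (here; there)
open import Data.List.Relation.Unary.Linked as Linked using (Linked; _∷_)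
open import Data.List.Relation.Unary.Unique.Propositional using (Unique)
import Data.List.Relation.Unary.Unique.Propositional.Properties as Unique
open import Data.Nat using (ℕ; zero; suc; _+_; _*_; _∸_; _⊓_; _≤_; _<_; _≥_; _≤?_; _<?_; z≤n; s≤s)
open import Data.Nat.ListAction using (sum)
open import Data.Nat.ListAction.Properties using (sum-++)
open import Data.Nat.Properties
open import Data.Nat.Solver using (module +-*-Solver)
open import Data.Product as Product using (_×_; _,_; proj₁; proj₂)
open import Data.Product.Properties using (,-injectiveˡ; ,-injectiveʳ)
open import Data.Rational as ℚ using (ℚ) renaming (_≤_ to _≤ℚ_)
import Data.Rational.Properties as ℚP
import Data.Rational.Unnormalised as ℚᵘ
import Data.Rational.Unnormalised.Properties as ℚᵘP
open import Data.Sum using (_⊎_; inj₁; inj₂)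
open import Level using (Level)
open import Relation.Binary.Definitions using (DecidableEquality; tri<; tri≈; tri>)
open import Relation.Binary.PropositionalEquality
open import Relation.Nullary using (¬_; yes; no; contradiction)
open import Relation.Nullary.Decidable using (_×-dec_)
open import Relation.Unary using (Pred; Decidable)
open import Relation.Unary.Properties using (∁?)

private variable
  a p q : Level
  A : Set a

module _ {P : Pred A p} (P? : Decidable P) where

  length-filter-∁ : ∀ xs → length (filter P? xs) + length (filter (∁? P?) xs) ≡ length xs
  length-filter-∁ [] = refl
  length-filter-∁ (x ∷ xs) with P? x
  ... | yes _ = cong suc (length-filter-∁ xs)
  ... | no _ = trans (+-suc _ _) (cong suc (length-filter-∁ xs))

  sumℤ-filter-∁ : (w : A → ℤ) → ∀ xs →
    sumℤ (map w (filter P? xs)) ℤ.+ sumℤ (map w (filter (∁? P?) xs)) ≡ sumℤ (map w xs)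
  sumℤ-filter-∁ w [] = refl
  sumℤ-filter-∁ w (x ∷ xs) with P? x
  ... | yes _ = trans (ℤP.+-assoc (w x) _ _) (cong (ℤ._+_ (w x)) (sumℤ-filter-∁ w xs))
  ... | no _ = trans (x∙yz≈y∙xz (sumℤ (map w (filter P? xs))) (w x) _) (cong (ℤ._+_ (w x)) (sumℤ-filter-∁ w xs))

Unique-All≡⇒length≤1 : ∀ {xs : List A} {y} → Unique xs → All (_≡ y) xs → length xs ≤ 1
Unique-All≡⇒length≤1 {xs = []} _ _ = z≤n
Unique-All≡⇒length≤1 {xs = _ ∷ []} _ _ = s≤s z≤n
Unique-All≡⇒length≤1 {xs = _ ∷ _ ∷ _} ((x≢x′ ∷ _) ∷ _) (x≡y ∷ x′≡y ∷ _) =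
  contradiction (trans x≡y (sym x′≡y)) x≢x′

module _ (_≟_ : DecidableEquality A) where

  Unique-⊆⇒length≤ : ∀ {xs ys : List A} → Unique xs → xs ⊆ ys → length xs ≤ length ys
  Unique-⊆⇒length≤ {[]} _ _ = z≤n
  Unique-⊆⇒length≤ {_ ∷ _} {[]} _ xs⊆[] with () ← xs⊆[] (here refl)
  Unique-⊆⇒length≤ {xs} {y ∷ ys} xs! xs⊆y∷ys = begin
    length xs                                                    ≡⟨ sym (length-filter-∁ (_≟ y) xs) ⟩
    length (filter (_≟ y) xs) + length (filter (∁? (_≟ y)) xs)  ≤⟨ +-mono-≤ copiesOfY others ⟩
    1 + length ys                                                ∎
    where
    open ≤-Reasoning
    copiesOfY : length (filter (_≟ y) xs) ≤ 1
    copiesOfY = Unique-All≡⇒length≤1 (Unique.filter⁺ (_≟ y) xs!) (all-filter (_≟ y) xs)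
    others⊆ys : filter (∁? (_≟ y)) xs ⊆ ys
    others⊆ys v∈ with v∈xs , v≢y ← ∈-filter⁻ (∁? (_≟ y)) v∈ with xs⊆y∷ys v∈xs
    ... | here v≡y = contradiction v≡y v≢y
    ... | there v∈ys = v∈ys
    others : length (filter (∁? (_≟ y)) xs) ≤ length ys
    others = Unique-⊆⇒length≤ (Unique.filter⁺ (∁? (_≟ y)) xs!) others⊆ys

Unique-map⁺ : ∀ {b} {B : Set b} {f : A → B} {xs} →
  (∀ {x y} → x ∈ xs → y ∈ xs → f x ≡ f y → x ≡ y) → Unique xs → Unique (map f xs)
Unique-map⁺ {xs = []} _ [] = []
Unique-map⁺ {xs = x ∷ xs} f-inj (x∉xs ∷ xs!) =
  All-map⁺ (All.tabulate (λ y∈xs fx≡fy → All.lookup x∉xs y∈xs (f-inj (here refl) (there y∈xs) fx≡fy)))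
  ∷ Unique-map⁺ (λ x∈ y∈ → f-inj (there x∈) (there y∈)) xs!

sumℤ-mono-pairwise : (w : A → ℤ) {xs ys : List A} → length xs ≡ length ys →
  (∀ {x y} → x ∈ xs → y ∈ ys → w x ℤ.≤ w y) → sumℤ (map w xs) ℤ.≤ sumℤ (map w ys)
sumℤ-mono-pairwise w {[]} {[]} _ _ = ℤP.≤-refl
sumℤ-mono-pairwise w {x ∷ xs} {y ∷ ys} eq x≤y =
  ℤP.+-mono-≤ (x≤y (here refl) (here refl)) (sumℤ-mono-pairwise w (suc-injective eq) (λ x∈ y∈ → x≤y (there x∈) (there y∈)))

module _ {P : Pred A p} {Q : Pred A q} (P? : Decidable P) (Q? : Decidable Q) where

  filter-comm : ∀ xs → filter P? (filter Q? xs) ≡ filter Q? (filter P? xs)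
  filter-comm [] = refl
  filter-comm (x ∷ xs) with P? x in eqP | Q? x in eqQ
  ... | yes _ | yes _ rewrite eqP rewrite eqQ = cong (x ∷_) (filter-comm xs)
  ... | yes _ | no _ rewrite eqQ = filter-comm xs
  ... | no _ | yes _ rewrite eqP = filter-comm xs
  ... | no _ | no _ = filter-comm xs

  length-filter-differences : ∀ xs → length (filter P? xs) ≡ length (filter Q? xs) →
    length (filter (∁? P?) (filter Q? xs)) ≡ length (filter (∁? Q?) (filter P? xs))
  length-filter-differences xs |P|≡|Q| = +-cancelˡ-≡ (length (filter P? (filter Q? xs))) _ _ (begin
    length (filter P? (filter Q? xs)) + length (filter (∁? P?) (filter Q? xs)) ≡⟨ length-filter-∁ P? (filter Q? xs) ⟩
    length (filter Q? xs)                                                        ≡⟨ sym |P|≡|Q| ⟩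
    length (filter P? xs)                                                        ≡⟨ sym (length-filter-∁ Q? (filter P? xs)) ⟩
    length (filter Q? (filter P? xs)) + length (filter (∁? Q?) (filter P? xs))  ≡⟨ cong (λ zs → length zs + length (filter (∁? Q?) (filter P? xs))) (sym (filter-comm xs)) ⟩
    length (filter P? (filter Q? xs)) + length (filter (∁? Q?) (filter P? xs))  ∎)
    where open ≡-Reasoning

  sumℤ-filter-exchange : (w : A → ℤ) → ∀ xs →
    length (filter P? xs) ≡ length (filter Q? xs) →
    (∀ {x y} → x ∈ xs → y ∈ xs → P x → ¬ Q x → Q y → ¬ P y → w y ℤ.≤ w x) →
    sumℤ (map w (filter Q? xs)) ℤ.≤ sumℤ (map w (filter P? xs))
  sumℤ-filter-exchange w xs |P|≡|Q| Q∖P≤P∖Q = begin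
    sumℤ (map w (filter Q? xs))                                       ≡⟨ sym (sumℤ-filter-∁ P? w (filter Q? xs)) ⟩
    sumℤ (map w (filter P? (filter Q? xs))) ℤ.+ sumℤ (map w onlyQ)  ≤⟨ ℤP.+-monoʳ-≤ (sumℤ (map w (filter P? (filter Q? xs)))) onlyQ≤onlyP ⟩
    sumℤ (map w (filter P? (filter Q? xs))) ℤ.+ sumℤ (map w onlyP)  ≡⟨ cong (λ zs → sumℤ (map w zs) ℤ.+ sumℤ (map w onlyP)) (filter-comm xs) ⟩
    sumℤ (map w (filter Q? (filter P? xs))) ℤ.+ sumℤ (map w onlyP)  ≡⟨ sumℤ-filter-∁ Q? w (filter P? xs) ⟩
    sumℤ (map w (filter P? xs))                                       ∎
    where
    open ℤP.≤-Reasoning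
    onlyP = filter (∁? Q?) (filter P? xs)
    onlyQ = filter (∁? P?) (filter Q? xs)
    onlyQ≤onlyP : sumℤ (map w onlyQ) ℤ.≤ sumℤ (map w onlyP)
    onlyQ≤onlyP = sumℤ-mono-pairwise w (length-filter-differences xs |P|≡|Q|) λ y∈ x∈ →
      let y∈Q , ¬Py = ∈-filter⁻ (∁? P?) y∈ ; y∈xs , Qy = ∈-filter⁻ Q? y∈Q
          x∈P , ¬Qx = ∈-filter⁻ (∁? Q?) x∈ ; x∈xs , Px = ∈-filter⁻ P? x∈P
      in Q∖P≤P∖Q x∈xs y∈xs Px ¬Qx Qy ¬Py

prefixSum : (ℕ → ℕ) → ℕ → ℕ
prefixSum r t = sum (applyUpTo (λ s → r (suc s)) t)

prefixSum-suc : ∀ r t → prefixSum r (suc t) ≡ prefixSum r t + r (suc t)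
prefixSum-suc r t = begin
  sum (applyUpTo (λ s → r (suc s)) (suc t))             ≡⟨ cong sum (applyUpTo-∷ʳ (λ s → r (suc s)) t) ⟨
  sum (applyUpTo (λ s → r (suc s)) t ++ r (suc t) ∷ [])  ≡⟨ sum-++ (applyUpTo (λ s → r (suc s)) t) _ ⟩
  prefixSum r t + (r (suc t) + 0)                        ≡⟨ cong (prefixSum r t +_) (+-identityʳ _) ⟩
  prefixSum r t + r (suc t)                              ∎
  where open ≡-Reasoning

prefixSum-mono-≤ : ∀ r {s t} → s ≤ t → prefixSum r s ≤ prefixSum r t
prefixSum-mono-≤ r {t = zero} z≤n = ≤-refl
prefixSum-mono-≤ r {s} {suc t} s≤1+t with m≤n⇒m<n∨m≡n s≤1+t
... | inj₂ refl = ≤-refl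
... | inj₁ (s≤s s≤t) = begin
  prefixSum r s              ≤⟨ prefixSum-mono-≤ r s≤t ⟩
  prefixSum r t              ≤⟨ m≤m+n _ _ ⟩
  prefixSum r t + r (suc t)  ≡⟨ prefixSum-suc r t ⟨
  prefixSum r (suc t)        ∎
  where open ≤-Reasoning

prefixSum-zero : ∀ t → prefixSum (λ _ → 0) t ≡ 0
prefixSum-zero zero = refl
prefixSum-zero (suc t) = prefixSum-zero t

InDiagram : (ℕ → ℕ) → ℕ → ℕ → Set
InDiagram r i j = 1 ≤ i × 1 ≤ j × j ≤ r i

readingTableau : (ℕ → ℕ) → Filling
readingTableau r i j = prefixSum r (i ∸ 1) + j

module _ (r : ℕ → ℕ) where

  readingTableau-≤-prefixSum : ∀ {i j} → 1 ≤ i → j ≤ r i → readingTableau r i j ≤ prefixSum r i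
  readingTableau-≤-prefixSum {suc i} _ j≤rᵢ = begin
    prefixSum r i + _          ≤⟨ +-monoʳ-≤ (prefixSum r i) j≤rᵢ ⟩
    prefixSum r i + r (suc i)  ≡⟨ prefixSum-suc r i ⟨
    prefixSum r (suc i)        ∎
    where open ≤-Reasoning

  readingTableau-<-lowerRow : ∀ {i j i′ j′} → InDiagram r i j → 1 ≤ j′ → i < i′ →
    readingTableau r i j < readingTableau r i′ j′
  readingTableau-<-lowerRow {i} {j} {suc i′} {j′} (1≤i , _ , j≤rᵢ) 1≤j′ (s≤s i≤i′) = begin-strict
    readingTableau r i j  ≤⟨ readingTableau-≤-prefixSum 1≤i j≤rᵢ ⟩
    prefixSum r i         ≤⟨ prefixSum-mono-≤ r i≤i′ ⟩
    prefixSum r i′        <⟨ m<m+n (prefixSum r i′) 1≤j′ ⟩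
    prefixSum r i′ + j′   ∎
    where open ≤-Reasoning

  readingTableau-<⇒lex : ∀ {i j i′ j′} → InDiagram r i j → InDiagram r i′ j′ →
    readingTableau r i′ j′ < readingTableau r i j → i′ < i ⊎ (i′ ≡ i × j′ < j)
  readingTableau-<⇒lex {i} {j} {i′} {j′} ij∈ i′j′∈ R′<R with <-cmp i′ i
  ... | tri< i′<i _ _ = inj₁ i′<i
  ... | tri≈ _ refl _ = inj₂ (refl , +-cancelˡ-< (prefixSum r (i ∸ 1)) j′ j R′<R)
  ... | tri> _ _ i<i′ = contradiction (readingTableau-<-lowerRow ij∈ (proj₁ (proj₂ i′j′∈)) i<i′) (<-asym R′<R)

  readingTableau-injective : ∀ {i j i′ j′} → InDiagram r i j → InDiagram r i′ j′ →
    readingTableau r i j ≡ readingTableau r i′ j′ → i ≡ i′ × j ≡ j′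
  readingTableau-injective {i} {j} {i′} {j′} ij∈ i′j′∈ R≡R′ with <-cmp i i′
  ... | tri< i<i′ _ _ = contradiction (readingTableau-<-lowerRow ij∈ (proj₁ (proj₂ i′j′∈)) i<i′) (<-irrefl R≡R′)
  ... | tri≈ _ refl _ = refl , +-cancelˡ-≡ (prefixSum r (i ∸ 1)) j j′ R≡R′
  ... | tri> _ _ i′<i = contradiction (readingTableau-<-lowerRow i′j′∈ (proj₁ (proj₂ ij∈)) i′<i) (<-irrefl (sym R≡R′))

rowLen-≤-head : ∀ {x xs} → Linked _≥_ (x ∷ xs) → ∀ i → rowLen (x ∷ xs) i ≤ x
rowLen-≤-head _ zero = z≤n
rowLen-≤-head _ (suc zero) = ≤-refl
rowLen-≤-head {xs = []} _ (suc (suc i)) = z≤n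
rowLen-≤-head {xs = _ ∷ _} (y≤x ∷ λ↓) (suc (suc i)) = ≤-trans (rowLen-≤-head λ↓ (suc i)) y≤x

rowLen-suc-≤ : ∀ {λs} → Linked _≥_ λs → ∀ {i} → 1 ≤ i → rowLen λs (suc i) ≤ rowLen λs i
rowLen-suc-≤ {[]} _ _ = z≤n
rowLen-suc-≤ {_ ∷ _} λ↓ {suc zero} _ = rowLen-≤-head λ↓ 2
rowLen-suc-≤ {_ ∷ _} λ↓ {suc (suc i)} _ = rowLen-suc-≤ (Linked.tail λ↓) (s≤s z≤n)

InShape-up : ∀ {λs i j} → Linked _≥_ λs → 1 ≤ i → InShape λs (suc i) j → InShape λs i j
InShape-up λ↓ 1≤i (_ , 1≤j , j≤r) = 1≤i , 1≤j , ≤-trans j≤r (rowLen-suc-≤ λ↓ 1≤i)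

InShape-left : ∀ {λs i j} → 1 ≤ j → InShape λs i (suc j) → InShape λs i j
InShape-left 1≤j (1≤i , _ , 1+j≤r) = 1≤i , 1≤j , ≤-trans (n≤1+n _) 1+j≤r

colLen-∷-≤ : ∀ {x xs c} → c ≤ x → colLen (x ∷ xs) c ≡ suc (colLen xs c)
colLen-∷-≤ c≤x = cong length (filter-accept (_ ≤?_) c≤x)

colLen-∷-≰ : ∀ {x xs c} → ¬ c ≤ x → colLen (x ∷ xs) c ≡ colLen xs c
colLen-∷-≰ c≰x = cong length (filter-reject (_ ≤?_) c≰x)

InShape⇒≤colLen : ∀ {λs i j} → Linked _≥_ λs → InShape λs i j → i ≤ colLen λs j
InShape⇒≤colLen {[]} _ (_ , s≤s _ , ())
InShape⇒≤colLen {_ ∷ _} {suc zero} _ (_ , _ , j≤x) =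
  subst (1 ≤_) (sym (colLen-∷-≤ j≤x)) (s≤s z≤n)
InShape⇒≤colLen {x ∷ _} {suc (suc i)} {j} λ↓ (_ , 1≤j , j≤r) =
  subst (suc (suc i) ≤_) (sym (colLen-∷-≤ j≤x)) (s≤s (InShape⇒≤colLen (Linked.tail λ↓) (s≤s z≤n , 1≤j , j≤r)))
  where
  j≤x : j ≤ x
  j≤x = ≤-trans j≤r (rowLen-≤-head λ↓ (suc (suc i)))

InShape⇒InConjugate : ∀ {λs i j} → Linked _≥_ λs → InShape λs i j → InDiagram (colLen λs) j i
InShape⇒InConjugate λ↓ ij∈@(1≤i , 1≤j , _) = 1≤j , 1≤i , InShape⇒≤colLen λ↓ ij∈

prefixSum-rowLen≡sum-take : ∀ λs q → prefixSum (rowLen λs) q ≡ sum (take q λs)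
prefixSum-rowLen≡sum-take _ zero = refl
prefixSum-rowLen≡sum-take [] (suc q) = prefixSum-zero q
prefixSum-rowLen≡sum-take (x ∷ xs) (suc q) = cong (x +_) (prefixSum-rowLen≡sum-take xs q)

prefixSum-rowLen-≤ : ∀ λs q → prefixSum (rowLen λs) q ≤ sum λs
prefixSum-rowLen-≤ [] q = ≤-reflexive (prefixSum-zero q)
prefixSum-rowLen-≤ (x ∷ xs) zero = z≤n
prefixSum-rowLen-≤ (x ∷ xs) (suc q) = +-monoʳ-≤ x (prefixSum-rowLen-≤ xs q)

-- The first q columns meet the row x in q ⊓ x cells.
prefixSum-colLen-∷ : ∀ x xs q → prefixSum (colLen (x ∷ xs)) q ≤ q ⊓ x + prefixSum (colLen xs) q
prefixSum-colLen-∷ x xs zero = z≤n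
prefixSum-colLen-∷ x xs (suc q) with suc q ≤? x
... | yes 1+q≤x = begin
  prefixSum (colLen (x ∷ xs)) (suc q)                        ≡⟨ prefixSum-suc (colLen (x ∷ xs)) q ⟩
  prefixSum (colLen (x ∷ xs)) q + colLen (x ∷ xs) (suc q)    ≤⟨ +-mono-≤ (prefixSum-colLen-∷ x xs q) (≤-reflexive (colLen-∷-≤ 1+q≤x)) ⟩
  q ⊓ x + P q + suc (colLen xs (suc q))                       ≡⟨ cong (λ t → t + P q + suc (colLen xs (suc q))) (m≤n⇒m⊓n≡m (<⇒≤ 1+q≤x)) ⟩
  q + P q + suc (colLen xs (suc q))                           ≡⟨ rearrange q (P q) (colLen xs (suc q)) ⟩
  suc q + (P q + colLen xs (suc q))                           ≡⟨ cong₂ _+_ (m≤n⇒m⊓n≡m 1+q≤x) (prefixSum-suc (colLen xs) q) ⟨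
  suc q ⊓ x + P (suc q)                                       ∎
  where
  open ≤-Reasoning
  open +-*-Solver
  P = prefixSum (colLen xs)
  rearrange : ∀ a b c → a + b + suc c ≡ suc a + (b + c)
  rearrange = solve 3 (λ a b c → a :+ b :+ (con 1 :+ c) := con 1 :+ a :+ (b :+ c)) refl
... | no 1+q≰x = begin
  prefixSum (colLen (x ∷ xs)) (suc q)                        ≡⟨ prefixSum-suc (colLen (x ∷ xs)) q ⟩
  prefixSum (colLen (x ∷ xs)) q + colLen (x ∷ xs) (suc q)    ≤⟨ +-mono-≤ (prefixSum-colLen-∷ x xs q) (≤-reflexive (colLen-∷-≰ 1+q≰x)) ⟩
  q ⊓ x + P q + colLen xs (suc q)                             ≤⟨ +-monoˡ-≤ _ (+-monoˡ-≤ (P q) (⊓-monoˡ-≤ x (n≤1+n q))) ⟩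
  suc q ⊓ x + P q + colLen xs (suc q)                         ≡⟨ +-assoc (suc q ⊓ x) (P q) _ ⟩
  suc q ⊓ x + (P q + colLen xs (suc q))                       ≡⟨ cong (suc q ⊓ x +_) (prefixSum-suc (colLen xs) q) ⟨
  suc q ⊓ x + P (suc q)                                       ∎
  where
  open ≤-Reasoning
  P = prefixSum (colLen xs)

prefixSum-colLen-≤ : ∀ λs q → prefixSum (colLen λs) q ≤ sum λs
prefixSum-colLen-≤ [] q = ≤-reflexive (prefixSum-zero q)
prefixSum-colLen-≤ (x ∷ xs) q = ≤-trans (prefixSum-colLen-∷ x xs q) (+-mono-≤ (m⊓n≤n q x) (prefixSum-colLen-≤ xs q))

rowReading : List ℕ → Filling
rowReading λs = readingTableau (rowLen λs)

colReading : List ℕ → Filling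
colReading λs i j = readingTableau (colLen λs) j i

rowTableau≗rowReading : ∀ λs i j → rowTableau λs i j ≡ rowReading λs i j
rowTableau≗rowReading λs i j = cong (_+ j) (sym (prefixSum-rowLen≡sum-take λs (i ∸ 1)))

colTableau≗colReading : ∀ λs i j → colTableau λs i j ≡ colReading λs i j
colTableau≗colReading λs i j = cong (λ s → sum s + i)
  (trans (cong (map (colLen λs)) (map-upTo suc (j ∸ 1))) (map-applyUpTo suc (colLen λs) (j ∸ 1)))

cellsFrom-suc : ∀ r λs → cellsFrom (suc r) λs ≡ map (Product.map₁ suc) (cellsFrom r λs)
cellsFrom-suc r [] = refl
cellsFrom-suc r (x ∷ xs) = begin
  map (λ j → (suc r , suc j)) (upTo x) ++ cellsFrom (suc (suc r)) xs
    ≡⟨ cong₂ _++_ (map-∘ (upTo x)) (cellsFrom-suc (suc r) xs) ⟩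
  map (Product.map₁ suc) (map (λ j → (r , suc j)) (upTo x)) ++ map (Product.map₁ suc) (cellsFrom (suc r) xs)
    ≡⟨ map-++ (Product.map₁ suc) (map (λ j → (r , suc j)) (upTo x)) _ ⟨
  map (Product.map₁ suc) (cellsFrom r (x ∷ xs))
    ∎
  where open ≡-Reasoning

firstRow : ℕ → List (ℕ × ℕ)
firstRow x = map (λ j → (1 , suc j)) (upTo x)

cells-∷ : ∀ x xs → cells (x ∷ xs) ≡ firstRow x ++ map (Product.map₁ suc) (cells xs)
cells-∷ x xs = cong (firstRow x ++_) (cellsFrom-suc 1 xs)

∈-cells⁻ : ∀ λs {c} → c ∈ cells λs → InShape λs (proj₁ c) (proj₂ c)
∈-cells⁻ (x ∷ xs) c∈ with ∈-++⁻ (firstRow x) (subst (_ ∈_) (cells-∷ x xs) c∈)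
... | inj₁ c∈row with j , j∈ , refl ← ∈-map⁻ _ c∈row = ≤-refl , s≤s z≤n , ∈-upTo⁻ j∈
... | inj₂ c∈rest with (i , j) , c′∈ , refl ← ∈-map⁻ _ c∈rest with ∈-cells⁻ xs c′∈
...   | s≤s z≤n , 1≤j , j≤r = s≤s z≤n , 1≤j , j≤r

cells-unique : ∀ λs → Unique (cells λs)
cells-unique [] = []
cells-unique (x ∷ xs) = subst Unique (sym (cells-∷ x xs))
  (Unique.++⁺ (Unique.map⁺ (λ e → suc-injective (,-injectiveʳ e)) (Unique.upTo⁺ x))
              (Unique.map⁺ (λ e → cong₂ _,_ (suc-injective (,-injectiveˡ e)) (,-injectiveʳ e)) (cells-unique xs))
              disjoint)
  where
  disjoint : ∀ {c} → c ∈ firstRow x × c ∈ map (Product.map₁ suc) (cells xs) → ⊥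
  disjoint (c∈row , c∈rest)
    with _ , _ , refl ← ∈-map⁻ _ c∈row
    with (i , _) , c′∈ , rows≡ ← ∈-map⁻ _ c∈rest
    with refl ← suc-injective (,-injectiveˡ rows≡)
    with () ← proj₁ (∈-cells⁻ xs c′∈)

length-cells : ∀ λs → length (cells λs) ≡ sum λs
length-cells [] = refl
length-cells (x ∷ xs) = begin
  length (cells (x ∷ xs))                                                  ≡⟨ cong length (cells-∷ x xs) ⟩
  length (firstRow x ++ map (Product.map₁ suc) (cells xs))                 ≡⟨ length-++ (firstRow x) ⟩
  length (firstRow x) + length (map (Product.map₁ suc) (cells xs))         ≡⟨ cong₂ _+_ (trans (length-map _ (upTo x)) (length-upTo x))
                                                                                          (trans (length-map _ (cells xs)) (length-cells xs)) ⟩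
  x + sum xs                                                               ∎
  where open ≡-Reasoning

-- The reading tableaux are not SYTs in the sense of Defs (rowIncr and colIncr also constrain
-- row 0 and column 0), so counting arguments only assume range and injectivity.
record StandardFilling (n : ℕ) (λs : List ℕ) (T : Filling) : Set where
  field
    range : ∀ i j → InShape λs i j → 1 ≤ T i j × T i j ≤ n
    inj   : ∀ i j i′ j′ → InShape λs i j → InShape λs i′ j′ → T i j ≡ T i′ j′ → i ≡ i′ × j ≡ j′

SYT⇒StandardFilling : ∀ {n λs S} → SYT n λs S → StandardFilling n λs S
SYT⇒StandardFilling S-syt = record { range = SYT.range S-syt ; inj = SYT.inj S-syt }

between? : (m n : ℕ) (T : Filling) → Decidable (λ (c : ℕ × ℕ) → m < T (proj₁ c) (proj₂ c) × T (proj₁ c) (proj₂ c) ≤ n)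
between? m n T c = (m <? T (proj₁ c) (proj₂ c)) ×-dec (T (proj₁ c) (proj₂ c) ≤? n)

¬between⇒≤ : ∀ {m n v} → ¬ (m < v × v ≤ n) → v ≤ n → v ≤ m
¬between⇒≤ ¬m<v≤n v≤n = ≮⇒≥ λ m<v → ¬m<v≤n (m<v , v≤n)

interval : ℕ → ℕ → List ℕ
interval a b = applyUpTo (_+ suc a) (b ∸ a)

∈-interval : ∀ {a b v} → a < v → v ≤ b → v ∈ interval a b
∈-interval {a} {b} {v} a<v v≤b =
  subst (_∈ interval a b) (m∸n+n≡m a<v) (∈-applyUpTo⁺ (_+ suc a) v∸1+a<b∸a)
  where
  v∸1+a<b∸a : v ∸ suc a < b ∸ a
  v∸1+a<b∸a = ≤-trans (≤-reflexive (sym (+-∸-assoc 1 a<v))) (∸-monoˡ-≤ a v≤b)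

StandardFilling-count : ∀ {n λs T} → sum λs ≡ n → StandardFilling n λs T → ∀ m →
  length (filter (between? m n T) (cells λs)) ≡ n ∸ m
StandardFilling-count {n} {λs} {T} Σλ≡n T-std m = ≤-antisym high≤ high≥
  where
  open StandardFilling T-std
  entry : ℕ × ℕ → ℕ
  entry (i , j) = T i j

  cells-with : ∀ {p} {P : Pred (ℕ × ℕ) p} → Decidable P → List (ℕ × ℕ)
  cells-with P? = filter P? (cells λs)

  length-cells-with≤ : ∀ {p} {P : Pred (ℕ × ℕ) p} (P? : Decidable P) {a b} →
    (∀ {c} → c ∈ cells-with P? → a < entry c × entry c ≤ b) → length (cells-with P?) ≤ b ∸ a
  length-cells-with≤ P? {a} {b} bounds = begin
    length (cells-with P?)              ≡⟨ length-map entry (cells-with P?) ⟨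
    length (map entry (cells-with P?))  ≤⟨ Unique-⊆⇒length≤ _≟_ entries-unique entries⊆interval ⟩
    length (interval a b)               ≡⟨ length-applyUpTo _ (b ∸ a) ⟩
    b ∸ a                               ∎
    where
    open ≤-Reasoning
    entries-unique : Unique (map entry (cells-with P?))
    entries-unique = Unique-map⁺
      (λ { {i , j} {i′ , j′} c∈ c′∈ Tc≡Tc′ →
           let i≡i′ , j≡j′ = inj i j i′ j′ (∈-cells⁻ λs (proj₁ (∈-filter⁻ P? c∈)))
                                           (∈-cells⁻ λs (proj₁ (∈-filter⁻ P? c′∈))) Tc≡Tc′
           in cong₂ _,_ i≡i′ j≡j′ })
      (Unique.filter⁺ P? (cells-unique λs))
    entries⊆interval : map entry (cells-with P?) ⊆ interval a b
    entries⊆interval v∈ with c , c∈ , refl ← ∈-map⁻ entry v∈ = ∈-interval (proj₁ (bounds c∈)) (proj₂ (bounds c∈))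

  high low : List (ℕ × ℕ)
  high = cells-with (between? m n T)
  low = cells-with (∁? (between? m n T))

  high≤ : length high ≤ n ∸ m
  high≤ = length-cells-with≤ (between? m n T) (λ c∈ → proj₂ (∈-filter⁻ (between? m n T) {xs = cells λs} c∈))

  low≤ : length low ≤ m
  low≤ = length-cells-with≤ (∁? (between? m n T)) λ c∈ →
    let c∈cells , not-between = ∈-filter⁻ (∁? (between? m n T)) c∈
        1≤Tc , Tc≤n = range _ _ (∈-cells⁻ λs c∈cells)
    in 1≤Tc , ¬between⇒≤ not-between Tc≤n

  high≥ : n ∸ m ≤ length high
  high≥ = m≤n+o⇒m∸n≤o n m (begin
    n                          ≡⟨ trans (sym Σλ≡n) (sym (length-cells λs)) ⟩
    length (cells λs)          ≡⟨ length-filter-∁ (between? m n T) (cells λs) ⟨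
    length high + length low   ≤⟨ +-monoʳ-≤ (length high) low≤ ⟩
    length high + m            ≡⟨ +-comm (length high) m ⟩
    m + length high            ∎)
    where open ≤-Reasoning

rowReading-standard : ∀ {n λs} → sum λs ≡ n → StandardFilling n λs (rowReading λs)
rowReading-standard {n} {λs} Σλ≡n = record
  { range = λ { i j (1≤i , 1≤j , j≤r) →
        ≤-trans 1≤j (m≤n+m j _)
      , ≤-trans (readingTableau-≤-prefixSum (rowLen λs) 1≤i j≤r) (subst (_ ≤_) Σλ≡n (prefixSum-rowLen-≤ λs i)) }
  ; inj = λ _ _ _ _ → readingTableau-injective (rowLen λs)
  }

colReading-standard : ∀ {n λs} → sum λs ≡ n → Linked _≥_ λs → StandardFilling n λs (colReading λs)
colReading-standard {n} {λs} Σλ≡n λ↓ = record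
  { range = λ { i j ij∈@(1≤i , 1≤j , _) →
        ≤-trans 1≤i (m≤n+m i _)
      , ≤-trans (readingTableau-≤-prefixSum (colLen λs) 1≤j (InShape⇒≤colLen λ↓ ij∈))
                (subst (_ ≤_) Σλ≡n (prefixSum-colLen-≤ λs j)) }
  ; inj = λ i j i′ j′ ij∈ i′j′∈ C≡C′ →
      let j≡j′ , i≡i′ = readingTableau-injective (colLen λs) (InShape⇒InConjugate λ↓ ij∈) (InShape⇒InConjugate λ↓ i′j′∈) C≡C′
      in i≡i′ , j≡j′
  }

module _ {n λs S} (S-syt : SYT n λs S) where
  open SYT S-syt

  SYT-row-mono : ∀ {i j j′} → InShape λs i j → 1 ≤ j′ → j′ ≤ j → S i j′ ≤ S i j
  SYT-row-mono {j = zero} (_ , () , _) _ _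
  SYT-row-mono {i} {suc j} ij∈ 1≤j′ j′≤1+j with m≤n⇒m<n∨m≡n j′≤1+j
  ... | inj₂ refl = ≤-refl
  ... | inj₁ (s≤s j′≤j) =
    ≤-trans (SYT-row-mono (InShape-left {λs} (≤-trans 1≤j′ j′≤j) ij∈) 1≤j′ j′≤j) (<⇒≤ (rowIncr i j ij∈))

  SYT-col-mono : Linked _≥_ λs → ∀ {i j i′} → InShape λs i j → 1 ≤ i′ → i′ ≤ i → S i′ j ≤ S i j
  SYT-col-mono _ {zero} (() , _)
  SYT-col-mono λ↓ {suc i} {j} ij∈ 1≤i′ i′≤1+i with m≤n⇒m<n∨m≡n i′≤1+i
  ... | inj₂ refl = ≤-refl
  ... | inj₁ (s≤s i′≤i) =
    ≤-trans (SYT-col-mono λ↓ (InShape-up λ↓ (≤-trans 1≤i′ i′≤i) ij∈) 1≤i′ i′≤i) (<⇒≤ (colIncr i j ij∈))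

  SYT-mono : Linked _≥_ λs → ∀ {i j i′ j′} → InShape λs i j → 1 ≤ i′ → 1 ≤ j′ → i′ ≤ i → j′ ≤ j →
    S i′ j′ ≤ S i j
  SYT-mono λ↓ ij∈@(1≤i , _ , j≤r) 1≤i′ 1≤j′ i′≤i j′≤j =
    ≤-trans (SYT-col-mono λ↓ (1≤i , 1≤j′ , ≤-trans j′≤j j≤r) 1≤i′ i′≤i) (SYT-row-mono ij∈ 1≤j′ j′≤j)

content : ℕ × ℕ → ℤ
content (i , j) = ℤ.+ j ℤ.- ℤ.+ i

content-mono : ∀ {i j i′ j′} → i ≤ i′ → j′ ≤ j → content (i′ , j′) ℤ.≤ content (i , j)
content-mono i≤i′ j′≤j = ℤP.+-mono-≤ (ℤ.+≤+ j′≤j) (ℤP.neg-mono-≤ (ℤ.+≤+ i≤i′))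

lex⇒≤ : ∀ {i j i′ j′ : ℕ} → i < i′ ⊎ (i ≡ i′ × j < j′) → i ≤ i′
lex⇒≤ (inj₁ i<i′) = <⇒≤ i<i′
lex⇒≤ (inj₂ (refl , _)) = ≤-refl

module _ {n λs S} (λ↓ : Linked _≥_ λs) (S-syt : SYT n λs S) where

  rowReading-separation : ∀ {i j i′ j′} → InShape λs i j → InShape λs i′ j′ →
    rowReading λs i j < rowReading λs i′ j′ → S i′ j′ < S i j → content (i′ , j′) ℤ.≤ content (i , j)
  rowReading-separation {i} {j} {i′} {j′} ij∈@(1≤i , 1≤j , _) i′j′∈ R<R′ S′<S = content-mono i≤i′ j′≤j
    where
    i≤i′ : i ≤ i′
    i≤i′ = lex⇒≤ (readingTableau-<⇒lex (rowLen λs) i′j′∈ ij∈ R<R′)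
    j′≤j : j′ ≤ j
    j′≤j = ≮⇒≥ λ j<j′ → <⇒≱ S′<S (SYT-mono S-syt λ↓ i′j′∈ 1≤i 1≤j i≤i′ (<⇒≤ j<j′))

  colReading-separation : ∀ {i j i′ j′} → InShape λs i j → InShape λs i′ j′ →
    S i j < S i′ j′ → colReading λs i′ j′ < colReading λs i j → content (i′ , j′) ℤ.≤ content (i , j)
  colReading-separation {i} {j} {i′} {j′} ij∈ i′j′∈@(1≤i′ , 1≤j′ , _) S<S′ C′<C = content-mono i≤i′ j′≤j
    where
    j′≤j : j′ ≤ j
    j′≤j = lex⇒≤ (readingTableau-<⇒lex (colLen λs) (InShape⇒InConjugate λ↓ ij∈) (InShape⇒InConjugate λ↓ i′j′∈) C′<C)
    i≤i′ : i ≤ i′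
    i≤i′ = ≮⇒≥ λ i′<i → <⇒≱ S<S′ (SYT-mono S-syt λ↓ ij∈ 1≤i′ 1≤j′ (<⇒≤ i′<i) j′≤j)

D-exchange : ∀ {n λs S T} → sum λs ≡ n → StandardFilling n λs S → StandardFilling n λs T →
  (∀ {i j i′ j′} → InShape λs i j → InShape λs i′ j′ → T i j < T i′ j′ → S i′ j′ < S i j →
     content (i′ , j′) ℤ.≤ content (i , j)) →
  ∀ k → D n k λs T ℤ.≤ D n k λs S
D-exchange {n} {λs} {S} {T} Σλ≡n S-std T-std separation k =
  sumℤ-filter-exchange (between? m n S) (between? m n T) content (cells λs)
    (trans (StandardFilling-count Σλ≡n S-std m) (sym (StandardFilling-count Σλ≡n T-std m)))
    λ { {i , j} {i′ , j′} ij∈ i′j′∈ (m<Sᵢⱼ , _) ¬Tᵢⱼ-top (m<T′ , _) ¬S′-top →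
        let ij∈λ = ∈-cells⁻ λs ij∈ ; i′j′∈λ = ∈-cells⁻ λs i′j′∈ in
        separation ij∈λ i′j′∈λ
          (≤-<-trans (¬between⇒≤ ¬Tᵢⱼ-top (proj₂ (StandardFilling.range T-std i j ij∈λ))) m<T′)
          (≤-<-trans (¬between⇒≤ ¬S′-top (proj₂ (StandardFilling.range S-std i′ j′ i′j′∈λ))) m<Sᵢⱼ) }
  where
  m : ℕ
  m = n ∸ k

D-cong : ∀ n k λs {S T} → (∀ i j → S i j ≡ T i j) → D n k λs S ≡ D n k λs T
D-cong n k λs {S} {T} S≗T = cong (λ cs → sumℤ (map content cs))
  (filter-≐ (between? (n ∸ k) n S) (between? (n ∸ k) n T)
    ((λ {c} → subst (λ v → n ∸ k < v × v ≤ n) (S≗T (proj₁ c) (proj₂ c)))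
    , (λ {c} → subst (λ v → n ∸ k < v × v ≤ n) (sym (S≗T (proj₁ c) (proj₂ c)))))
    (cells λs))

/1-mono-≤ : ∀ {x y : ℤ} → x ℤ.≤ y → x /' 1 ≤ℚ y /' 1
/1-mono-≤ {x} {y} x≤y = ℚP.toℚᵘ-cancel-≤ (begin
  ℚ.toℚᵘ (x ℚ./ 1)  ≃⟨ ℚP.toℚᵘ-fromℚᵘ (ℚᵘ.mkℚᵘ x 0) ⟩
  ℚᵘ.mkℚᵘ x 0       ≤⟨ ℚᵘ.*≤* (ℤP.*-monoʳ-≤-nonNeg (ℤ.+ 1) x≤y) ⟩
  ℚᵘ.mkℚᵘ y 0       ≃⟨ ℚP.toℚᵘ-fromℚᵘ (ℚᵘ.mkℚᵘ y 0) ⟨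
  ℚ.toℚᵘ (y ℚ./ 1)  ∎)
  where open ℚᵘP.≤-Reasoning

/'-nonNeg : ∀ a d → ℚ.NonNegative ((ℤ.+ a) /' d)
/'-nonNeg a zero = _
/'-nonNeg a (suc d) = ℚP.normalize-nonNeg a (suc d)

eig-mono : ∀ n k λs S T → D n k λs S ℤ.≤ D n k λs T → eig n k λs S ≤ℚ eig n k λs T
eig-mono n k _ _ _ D≤D = ℚP.+-monoʳ-≤ ((ℤ.+ 1) /' n)
  (ℚP.*-monoˡ-≤-nonNeg ((ℤ.+ num) /' den) {{/'-nonNeg num den}} (/1-mono-≤ D≤D))
  where
  num den : ℕ
  num = 2 * (n ∸ 1)
  den = n * k * (2 * n ∸ (k + 1))

-- The bounds on n and k are not needed: the coefficient of D in eig is nonnegative whatever they are.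
lemma4p1 : (n k : ℕ) (λs : List ℕ) → 2 ≤ n → 1 ≤ k → k ≤ n → Partition n λs →
           (S : Filling) → SYT n λs S →
           (eig n k λs (rowTableau λs) ≤ℚ eig n k λs S)
             × (eig n k λs S ≤ℚ eig n k λs (colTableau λs))
lemma4p1 n k λs _ _ _ (Σλ≡n , _ , λ↓) S S-syt =
  eig-mono n k λs (rowTableau λs) S rowTableau≤S , eig-mono n k λs S (colTableau λs) S≤colTableau
  where
  S-std : StandardFilling n λs S
  S-std = SYT⇒StandardFilling S-syt
  rowTableau≤S : D n k λs (rowTableau λs) ℤ.≤ D n k λs S
  rowTableau≤S = ℤP.≤-trans (ℤP.≤-reflexive (D-cong n k λs (rowTableau≗rowReading λs)))
    (D-exchange Σλ≡n S-std (rowReading-standard Σλ≡n) (rowReading-separation λ↓ S-syt) k)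
  S≤colTableau : D n k λs S ℤ.≤ D n k λs (colTableau λs)
  S≤colTableau = ℤP.≤-trans
    (D-exchange Σλ≡n (colReading-standard Σλ≡n λ↓) S-std (colReading-separation λ↓ S-syt) k)
    (ℤP.≤-reflexive (sym (D-cong n k λs (colTableau≗colReading λs))))
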